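{- Let $Q$ be a prime power, let $r$ be a positive integer, and let $\beta$ be a $(Q+1)$-th root of unity in $\mathbb{F}_{Q^2}$. Let $h(x)\in\mathbb{F}_{Q^2}[x]$ be a polynomial of degree $d$ such that $h(0)\ne 0$ and \[ \left(x^d \cdot h(1/x)\right)^Q=\beta \cdot h(x^Q) \] as polynomials. Then $f(x):=x^r h(x^{Q-1})$ permutes $\mathbb{F}_{Q^2}$ if and only if all of the following hold: (1) $\gcd(r,Q-1)=1$; (2) $\gcd(r-d,Q+1)=1$; (3) $h(x)$ has no roots in $\mu_{Q+1}$.
   Context: $\mu_{Q+1}$ denotes the set of $(Q+1)$-th roots of unity in an algebraic closure of $\mathbb{F}_Q$. A polynomial $f$ permutes $\mathbb{F}_{Q^2}$ if $\alpha\mapsto f(\alpha)$ is a bijection of $\mathbb{F}_{Q^2}$. -}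

module Defs where

open import Level using (Level; _⊔_; suc)
open import Algebra.Bundles using (CommutativeRing)
open import Data.Nat using (ℕ; zero; suc; _≥_)
open import Data.Nat.Primality using (Prime)
open import Data.Fin using (Fin)
open import Data.List using (List; []; _∷_; replicate; _++_; map)
open import Data.Product using (Σ; ∃; _×_; _,_)
open import Relation.Nullary using (¬_)
open import Relation.Binary.PropositionalEquality using (_≡_)
import Relation.Binary.PropositionalEquality as ≡
open import Function.Bundles using (Inverse)
open import Function.Definitions using (Bijective)

IsPrimePower : ℕ → Set
IsPrimePower Q = Σ ℕ λ p → Σ ℕ λ k → Prime p × k ≥ 1 × Q ≡ p Data.Nat.^ k

record Field (c ℓ : Level) : Set (Level.suc (c ⊔ ℓ)) where
  field
    commutativeRing : CommutativeRing c ℓ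
  open CommutativeRing commutativeRing public
  field
    1≉0     : ¬ (1# ≈ 0#)
    inverse : ∀ x → ¬ (x ≈ 0#) → ∃ λ y → x * y ≈ 1#

module FieldOps {c ℓ : Level} (F : Field c ℓ) where
  open Field F

  HasCardinality : ℕ → Set (c ⊔ ℓ)
  HasCardinality n = Inverse (≡.setoid (Fin n)) setoid

  infixr 8 _^′_
  _^′_ : Carrier → ℕ → Carrier
  a ^′ zero  = 1#
  a ^′ suc n = a * (a ^′ n)

  -- polynomials in F[x]: coefficient lists, constant term first
  Poly : Set c
  Poly = List Carrier

  coeff : Poly → ℕ → Carrier
  coeff []      _       = 0#
  coeff (a ∷ p) zero    = a
  coeff (a ∷ p) (suc n) = coeff p n

  -- equality of polynomials (coefficientwise; trailing zeros irrelevant)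
  infix 4 _≈ₚ_
  _≈ₚ_ : Poly → Poly → Set ℓ
  p ≈ₚ q = ∀ n → coeff p n ≈ coeff q n

  infixl 6 _+ₚ_
  _+ₚ_ : Poly → Poly → Poly
  []      +ₚ q       = q
  (a ∷ p) +ₚ []      = a ∷ p
  (a ∷ p) +ₚ (b ∷ q) = (a + b) ∷ (p +ₚ q)

  scale : Carrier → Poly → Poly
  scale a p = map (a *_) p

  infixl 7 _*ₚ_
  _*ₚ_ : Poly → Poly → Poly
  []      *ₚ q = []
  (a ∷ p) *ₚ q = scale a q +ₚ (0# ∷ (p *ₚ q))

  infixr 8 _^ₚ_
  _^ₚ_ : Poly → ℕ → Poly
  p ^ₚ zero  = 1# ∷ []
  p ^ₚ suc n = p *ₚ (p ^ₚ n)

  monomial : ℕ → Poly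
  monomial n = replicate n 0# ++ (1# ∷ [])

  compose : Poly → Poly → Poly
  compose []      g = []
  compose (a ∷ p) g = (a ∷ []) +ₚ (g *ₚ compose p g)

  eval : Poly → Carrier → Carrier
  eval []      α = 0#
  eval (a ∷ p) α = a + α * eval p α

  Permutes : (Carrier → Carrier) → Set (c ⊔ ℓ)
  Permutes f = Bijective _≈_ _≈_ f

-- For α ≠ 0 put u = α^(Q-1), a (Q+1)-th root of unity. Evaluating the functional equation at
-- u^Q = u⁻¹ gives u^d h(u)^Q = β h(u), so when h(u) ≠ 0 we get f(α)^(Q-1) u^d = β u^r. Hence
-- f(α) = f(γ) forces u^(r-d) = v^(r-d) for v = γ^(Q-1), so u = v when gcd(r-d, Q+1) = 1, then
-- α^r = γ^r and α = γ when gcd(r, Q-1) = 1; an injective map of a finite set is onto.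
-- Conversely, a root of h in μ_(Q+1), lifted to some z^(Q-1) by Hilbert 90, gives f(z) = 0 = f(0);
-- a w ≠ 1 with w^r = w^(Q-1) = 1 gives f(w) = f(1); and a w ≠ 1 in μ_(Q+1) with w^(r-d) = 1,
-- written w = z^(Q-1), gives f(z)^(Q-1) = β = f(1)^(Q-1), so f(tz) = f(1) for a suitable t ∈ μ_(Q-1).

{-# OPTIONS --safe #-}
module Submission where

open import Defs
open import Data.Nat using (ℕ; suc; _∸_; _≥_)
import Data.Nat as ℕ
open import Data.Nat.GCD using (gcd)
open import Data.Integer using (+_)
import Data.Integer as ℤ
open import Data.Integer.GCD using () renaming (gcd to gcdℤ)
open import Data.Vec using (Vec; head; last; toList; reverse)
open import Data.Product using (∃; _×_)
open import Function.Bundles using (_⇔_; mk⇔)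
open import Relation.Nullary using (¬_)
open import Relation.Binary.PropositionalEquality using (_≡_)

open import Level using (Level)
open import Data.Nat using (zero; _≤_; _<_; z≤n; s≤s; ∣_-_∣; _!)
open import Data.Nat.Properties as ℕ
  using (≤-trans; ≤-total; <⇒≤; n<1+n; <-trans; m+[n∸m]≡n)
open import Data.Nat.Divisibility using (_∣_; divides; ∣-trans; ∣1⇒≡1; ∣⇒≤; m∣m*n)
open import Data.Nat.Primality using (Prime; prime; prime⇒nonZero; euclidsLemma)
open import Data.Nat.Combinatorics using (_C_; nCn≡1; k![n∸k]!∣n!)
open import Data.Nat.Combinatorics.Specification using (nCk≡n!/k![n-k]!)
open import Data.Nat.DivMod using (m/n*n≡m)
open import Data.Nat.GCD using (GCD; gcd-GCD; module Bézout; gcd[m,n]∣m; gcd[m,n]∣n; gcd[m,n]≡0⇒n≡0)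
import Data.Integer.Properties as ℤ
open import Data.List using ([]; _∷_; _++_; length; replicate)
import Data.List as List
import Data.List.Properties as List
import Data.Vec as Vec
import Data.Vec.Properties as Vec
import Data.Vec.Functional as Vector
open import Data.Fin using (Fin; punchOut; toℕ; inject₁; fromℕ)
import Data.Fin.Properties as Fin
open import Data.Product using (_,_; proj₁; proj₂)
open import Data.Sum using (inj₁; inj₂)
open import Data.Empty using (⊥-elim)
open import Relation.Nullary using (yes; no)
open import Relation.Binary.PropositionalEquality as ≡
  using (_≢_; cong; cong₂; subst)

prime⇒2≤ : ∀ {p} → Prime p → 2 ≤ p
prime⇒2≤ {p} (prime _) = ℕ.nonTrivial⇒n>1 p

prime-power⇒2≤ : ∀ {Q} → IsPrimePower Q → 2 ≤ Q
prime-power⇒2≤ (p , suc k , p-prime , _ , ≡.refl) =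
  ℕ.*-mono-≤ (prime⇒2≤ p-prime) (ℕ.m^n>0 p {{prime⇒nonZero p-prime}} k)

prime∤! : ∀ {p} → Prime p → ∀ {j} → j < p → ¬ p ∣ j !
prime∤! p-prime {zero} _ p∣1 = ℕ.<⇒≢ (prime⇒2≤ p-prime) (≡.sym (∣1⇒≡1 p∣1))
prime∤! p-prime {suc j} j<p p∣j! with euclidsLemma (suc j) (j !) p-prime p∣j!
... | inj₁ p∣1+j = ℕ.<⇒≱ j<p (∣⇒≤ p∣1+j)
... | inj₂ p∣j!  = prime∤! p-prime (<-trans (n<1+n j) j<p) p∣j!

prime∣C : ∀ {p} → Prime p → ∀ {k} → 0 < k → k < p → p ∣ p C k
prime∣C {suc n} p-prime {k} 0<k k<p
  with euclidsLemma (suc n C k) (k ! ℕ.* (suc n ∸ k) !) p-prime p∣p!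
  where
  instance _ = k ℕ.!* (suc n ∸ k) !≢0
  C*k!*[p∸k]!≡p! : (suc n C k) ℕ.* (k ! ℕ.* (suc n ∸ k) !) ≡ suc n !
  C*k!*[p∸k]!≡p! = ≡.trans (cong (ℕ._* (k ! ℕ.* (suc n ∸ k) !)) (nCk≡n!/k![n-k]! (<⇒≤ k<p)))
                           (m/n*n≡m (k![n∸k]!∣n! (<⇒≤ k<p)))
  p∣p! : suc n ∣ (suc n C k) ℕ.* (k ! ℕ.* (suc n ∸ k) !)
  p∣p! = subst (suc n ∣_) (≡.sym C*k!*[p∸k]!≡p!) (m∣m*n (n !))
... | inj₁ p∣C = p∣C
... | inj₂ p∣k![p∸k]! with euclidsLemma (k !) ((suc n ∸ k) !) p-prime p∣k![p∸k]!
...   | inj₁ p∣k! = ⊥-elim (prime∤! p-prime k<p p∣k!)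
...   | inj₂ p∣[p∸k]! = ⊥-elim (prime∤! p-prime (ℕ.∸-monoʳ-< 0<k (<⇒≤ k<p)) p∣[p∸k]!)

∣m⊖n∣≡∣m-n∣ : ∀ m n → ℤ.∣ m ℤ.⊖ n ∣ ≡ ∣ m - n ∣
∣m⊖n∣≡∣m-n∣ m n with ≤-total m n
... | inj₁ m≤n = ≡.trans (ℤ.∣⊖∣-≤ m≤n) (≡.sym (ℕ.m≤n⇒∣m-n∣≡n∸m m≤n))
... | inj₂ n≤m = ≡.trans (ℤ.∣m⊖n∣≡∣n⊖m∣ m n)
                   (≡.trans (ℤ.∣⊖∣-≤ n≤m)
                     (≡.sym (≡.trans (ℕ.∣-∣-comm m n) (ℕ.m≤n⇒∣m-n∣≡n∸m n≤m))))

gcdℤ-distance : ∀ m n k → gcdℤ (+ m ℤ.- + n) (+ k) ≡ + gcd ∣ m - n ∣ k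
gcdℤ-distance m n k =
  cong (λ a → + gcd a k) (≡.trans (cong ℤ.∣_∣ (ℤ.m-n≡m⊖n m n)) (∣m⊖n∣≡∣m-n∣ m n))

≢0∧≢1⇒2≤ : ∀ {g} → g ≢ 0 → g ≢ 1 → 2 ≤ g
≢0∧≢1⇒2≤ {zero}        g≢0 g≢1 = ⊥-elim (g≢0 ≡.refl)
≢0∧≢1⇒2≤ {suc zero}    g≢0 g≢1 = ⊥-elim (g≢1 ≡.refl)
≢0∧≢1⇒2≤ {suc (suc g)} g≢0 g≢1 = s≤s (s≤s z≤n)

Fin-injective⇒surjective : ∀ {n} (g : Fin n → Fin n) → (∀ {i j} → g i ≡ g j → i ≡ j) →
                           ∀ y → ∃ λ i → g i ≡ y
Fin-injective⇒surjective {suc n} g g-inj y with Fin.any? (λ i → g i Fin.≟ y)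
... | yes hit = hit
... | no miss = ⊥-elim (ℕ.<-irrefl ≡.refl (Fin.injective⇒≤ punchOut-inj))
  where
  y≢g : ∀ i → y ≢ g i
  y≢g i y≡gi = miss (i , ≡.sym y≡gi)
  punchOut-inj : ∀ {i j} → punchOut (y≢g i) ≡ punchOut (y≢g j) → i ≡ j
  punchOut-inj {i} {j} eq = g-inj (Fin.punchOut-injective (y≢g i) (y≢g j) eq)

module FieldProperties {c ℓ : Level} (F : Field c ℓ) where
  open Field F
  open FieldOps F
  open import Algebra.Properties.Semiring.Exp semiring using (_^_; ^-homo-*; ^-assocʳ)
  open import Algebra.Properties.CommutativeSemiring.Exp commutativeSemiring using (^-distrib-*)
  open import Algebra.Solver.Ring.NaturalCoefficients.Default commutativeSemiring
  open import Algebra.Properties.Semiring.Mult semiring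
    using (×-congʳ; ×-assoc-*; ×1-homo-*) renaming (_×_ to _·_)
  import Algebra.Properties.Monoid.Sum +-monoid as Sum
  import Algebra.Properties.CommutativeSemiring.Binomial commutativeSemiring as Binomial
  open import Relation.Binary.Reasoning.Setoid setoid

  -- Powers and cancellation

  ^′≡^ : ∀ x n → x ^′ n ≡ x ^ n
  ^′≡^ x zero    = ≡.refl
  ^′≡^ x (suc n) = cong (x *_) (^′≡^ x n)

  ^′-congˡ : ∀ {x y} n → x ≈ y → x ^′ n ≈ y ^′ n
  ^′-congˡ zero    x≈y = refl
  ^′-congˡ (suc n) x≈y = *-cong x≈y (^′-congˡ n x≈y)

  ^′-homo-* : ∀ x m n → x ^′ (m ℕ.+ n) ≈ x ^′ m * x ^′ n
  ^′-homo-* x m n rewrite ^′≡^ x (m ℕ.+ n) | ^′≡^ x m | ^′≡^ x n = ^-homo-* x m n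

  ^′-assocʳ : ∀ x m n → (x ^′ m) ^′ n ≈ x ^′ (m ℕ.* n)
  ^′-assocʳ x m n rewrite ^′≡^ x m | ^′≡^ (x ^ m) n | ^′≡^ x (m ℕ.* n) = ^-assocʳ x m n

  ^′-distrib-* : ∀ x y n → (x * y) ^′ n ≈ x ^′ n * y ^′ n
  ^′-distrib-* x y n rewrite ^′≡^ (x * y) n | ^′≡^ x n | ^′≡^ y n = ^-distrib-* x y n

  ^′-comm : ∀ x m n → (x ^′ m) ^′ n ≈ (x ^′ n) ^′ m
  ^′-comm x m n = begin
    (x ^′ m) ^′ n   ≈⟨ ^′-assocʳ x m n ⟩
    x ^′ (m ℕ.* n)  ≡⟨ cong (x ^′_) (ℕ.*-comm m n) ⟩
    x ^′ (n ℕ.* m)  ≈⟨ ^′-assocʳ x n m ⟨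
    (x ^′ n) ^′ m   ∎

  1^′n≈1 : ∀ n → 1# ^′ n ≈ 1#
  1^′n≈1 zero    = refl
  1^′n≈1 (suc n) = trans (*-identityˡ _) (1^′n≈1 n)

  *-cancelˡ : ∀ {x y z} → x ≉ 0# → x * y ≈ x * z → y ≈ z
  *-cancelˡ {x} {y} {z} x≉0 xy≈xz with inverse x x≉0
  ... | x⁻¹ , xx⁻¹≈1 = begin
    y              ≈⟨ *-identityˡ y ⟨
    1# * y         ≈⟨ *-congʳ x⁻¹x≈1 ⟨
    x⁻¹ * x * y    ≈⟨ *-assoc x⁻¹ x y ⟩
    x⁻¹ * (x * y)  ≈⟨ *-congˡ xy≈xz ⟩
    x⁻¹ * (x * z)  ≈⟨ *-assoc x⁻¹ x z ⟨
    x⁻¹ * x * z    ≈⟨ *-congʳ x⁻¹x≈1 ⟩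
    1# * z         ≈⟨ *-identityˡ z ⟩
    z              ∎
    where
    x⁻¹x≈1 : x⁻¹ * x ≈ 1#
    x⁻¹x≈1 = trans (*-comm x⁻¹ x) xx⁻¹≈1

  *-cancelʳ : ∀ {x y z} → x ≉ 0# → y * x ≈ z * x → y ≈ z
  *-cancelʳ {x} {y} {z} x≉0 yx≈zx = *-cancelˡ x≉0 (trans (*-comm x y) (trans yx≈zx (*-comm z x)))

  *-nonzero : ∀ {x y} → x ≉ 0# → y ≉ 0# → x * y ≉ 0#
  *-nonzero {x} x≉0 y≉0 xy≈0 = y≉0 (*-cancelˡ x≉0 (trans xy≈0 (sym (zeroʳ x))))

  ^′-nonzero : ∀ {x} n → x ≉ 0# → x ^′ n ≉ 0#
  ^′-nonzero zero    x≉0 = 1≉0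
  ^′-nonzero (suc n) x≉0 = *-nonzero x≉0 (^′-nonzero n x≉0)

  root-of-unity⇒≉0 : ∀ {x} n → x ^′ suc n ≈ 1# → x ≉ 0#
  root-of-unity⇒≉0 n xⁿ⁺¹≈1 x≈0 = 1≉0 (trans (sym xⁿ⁺¹≈1) (trans (*-congʳ x≈0) (zeroˡ _)))

  ^′-≈-multiple : ∀ {a b} m → a ^′ m ≈ b ^′ m → ∀ k → a ^′ (m ℕ.* k) ≈ b ^′ (m ℕ.* k)
  ^′-≈-multiple {a} {b} m aᵐ≈bᵐ k = begin
    a ^′ (m ℕ.* k)  ≈⟨ ^′-assocʳ a m k ⟨
    (a ^′ m) ^′ k   ≈⟨ ^′-congˡ k aᵐ≈bᵐ ⟩
    (b ^′ m) ^′ k   ≈⟨ ^′-assocʳ b m k ⟩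
    b ^′ (m ℕ.* k)  ∎

  ^′≈1-∣ : ∀ {w g n} → w ^′ g ≈ 1# → g ∣ n → w ^′ n ≈ 1#
  ^′≈1-∣ {w} {g} wᵍ≈1 (divides k ≡.refl) = begin
    w ^′ (k ℕ.* g)  ≡⟨ cong (w ^′_) (ℕ.*-comm k g) ⟩
    w ^′ (g ℕ.* k)  ≈⟨ ^′-assocʳ w g k ⟨
    (w ^′ g) ^′ k   ≈⟨ ^′-congˡ k wᵍ≈1 ⟩
    1# ^′ k         ≈⟨ 1^′n≈1 k ⟩
    1#              ∎

  *≈1⇒≉0 : ∀ {x y} → x * y ≈ 1# → x ≉ 0#
  *≈1⇒≉0 {x} {y} xy≈1 x≈0 = 1≉0 (trans (sym xy≈1) (trans (*-congʳ x≈0) (zeroˡ y)))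

  ^′-inverse : ∀ {x y} → x * y ≈ 1# → ∀ n → x ^′ n * y ^′ n ≈ 1#
  ^′-inverse {x} {y} xy≈1 n = trans (sym (^′-distrib-* x y n)) (trans (^′-congˡ n xy≈1) (1^′n≈1 n))

  ^′-injective-bezout : ∀ {a b} m n x y → 1 ℕ.+ y ℕ.* n ≡ x ℕ.* m → b ≉ 0# →
                        a ^′ m ≈ b ^′ m → a ^′ n ≈ b ^′ n → a ≈ b
  ^′-injective-bezout {a} {b} m n x y eq b≉0 aᵐ≈bᵐ aⁿ≈bⁿ =
    *-cancelʳ (^′-nonzero (n ℕ.* y) b≉0) (begin
      a * b ^′ (n ℕ.* y)   ≈⟨ *-congˡ (^′-≈-multiple n aⁿ≈bⁿ y) ⟨
      a ^′ suc (n ℕ.* y)   ≡⟨ cong (a ^′_) 1+ny≡mx ⟩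
      a ^′ (m ℕ.* x)       ≈⟨ ^′-≈-multiple m aᵐ≈bᵐ x ⟩
      b ^′ (m ℕ.* x)       ≡⟨ cong (b ^′_) 1+ny≡mx ⟨
      b * b ^′ (n ℕ.* y)   ∎)
    where
    1+ny≡mx : suc (n ℕ.* y) ≡ m ℕ.* x
    1+ny≡mx = ≡.trans (cong suc (ℕ.*-comm n y)) (≡.trans eq (ℕ.*-comm x m))

  ^′-injective-coprime : ∀ {a b} m n → gcd m n ≡ 1 → b ≉ 0# →
                         a ^′ m ≈ b ^′ m → a ^′ n ≈ b ^′ n → a ≈ b
  ^′-injective-coprime m n gcd≡1 b≉0 aᵐ≈bᵐ aⁿ≈bⁿ
    with Bézout.identity (subst (GCD m n) gcd≡1 (gcd-GCD m n))
  ... | Bézout.+- x y eq = ^′-injective-bezout m n x y eq b≉0 aᵐ≈bᵐ aⁿ≈bⁿ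
  ... | Bézout.-+ x y eq = ^′-injective-bezout n m y x eq b≉0 aⁿ≈bⁿ aᵐ≈bᵐ

  root-of-unity-^′ : ∀ {c} n → c ^′ n ≈ 1# → ∀ k → (c ^′ k) ^′ n ≈ 1#
  root-of-unity-^′ {c} n cⁿ≈1 k = trans (^′-comm c k n) (trans (^′-congˡ k cⁿ≈1) (1^′n≈1 k))

  coprime-root : ∀ r n → gcd r n ≡ 1 → ∀ {c} → c ^′ n ≈ 1# → ∃ λ t → t ^′ r ≈ c × t ^′ n ≈ 1#
  coprime-root r n gcd≡1 {c} cⁿ≈1 with Bézout.identity (subst (GCD r n) gcd≡1 (gcd-GCD r n))
  ... | Bézout.+- x y eq = c ^′ x , tʳ≈c , root-of-unity-^′ n cⁿ≈1 x
    where
    tʳ≈c : (c ^′ x) ^′ r ≈ c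
    tʳ≈c = begin
      (c ^′ x) ^′ r        ≈⟨ ^′-assocʳ c x r ⟩
      c ^′ (x ℕ.* r)       ≡⟨ cong (c ^′_) eq ⟨
      c * c ^′ (y ℕ.* n)   ≈⟨ *-congˡ (^′≈1-∣ cⁿ≈1 (divides y ≡.refl)) ⟩
      c * 1#               ≈⟨ *-identityʳ c ⟩
      c                    ∎
  ... | Bézout.-+ x y eq = t , tʳ≈c , tⁿ≈1
    where
    s : Carrier
    s = c ^′ x
    csʳ≈1 : c * s ^′ r ≈ 1#
    csʳ≈1 = begin
      c * s ^′ r           ≈⟨ *-congˡ (^′-assocʳ c x r) ⟩
      c ^′ suc (x ℕ.* r)   ≡⟨ cong (c ^′_) eq ⟩
      c ^′ (y ℕ.* n)       ≈⟨ ^′≈1-∣ cⁿ≈1 (divides y ≡.refl) ⟩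
      1#                   ∎
    s≉0 : s ≉ 0#
    s≉0 = ^′-nonzero x (*≈1⇒≉0 csʳ≈1)
    t : Carrier
    t = proj₁ (inverse s s≉0)
    st≈1 : s * t ≈ 1#
    st≈1 = proj₂ (inverse s s≉0)
    tʳ≈c : t ^′ r ≈ c
    tʳ≈c = *-cancelʳ (^′-nonzero r s≉0)
      (trans (*-comm _ _) (trans (^′-inverse st≈1 r) (sym csʳ≈1)))
    tⁿ≈1 : t ^′ n ≈ 1#
    tⁿ≈1 = begin
      t ^′ n               ≈⟨ *-identityˡ _ ⟨
      1# * t ^′ n          ≈⟨ *-congʳ (root-of-unity-^′ n cⁿ≈1 x) ⟨
      s ^′ n * t ^′ n      ≈⟨ ^′-inverse st≈1 n ⟩
      1#                   ∎

  ∃-root-of-ratio : ∀ r n → gcd r n ≡ 1 → ∀ {a b} → a ≉ 0# → a ^′ n ≈ b ^′ n →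
                    ∃ λ t → t ^′ n ≈ 1# × t ^′ r * a ≈ b
  ∃-root-of-ratio r n gcd≡1 {a} {b} a≉0 aⁿ≈bⁿ =
    let t , tʳ≈ratio , tⁿ≈1 = coprime-root r n gcd≡1 ratioⁿ≈1
    in  t , tⁿ≈1 , trans (*-congʳ tʳ≈ratio) ratio*a≈b
    where
    a⁻¹ : Carrier
    a⁻¹ = proj₁ (inverse a a≉0)
    aa⁻¹≈1 : a * a⁻¹ ≈ 1#
    aa⁻¹≈1 = proj₂ (inverse a a≉0)
    ratio : Carrier
    ratio = b * a⁻¹
    ratio*a≈b : ratio * a ≈ b
    ratio*a≈b = trans (*-assoc b a⁻¹ a) (trans (*-congˡ (trans (*-comm a⁻¹ a) aa⁻¹≈1)) (*-identityʳ b))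
    ratioⁿ≈1 : ratio ^′ n ≈ 1#
    ratioⁿ≈1 = begin
      (b * a⁻¹) ^′ n           ≈⟨ ^′-distrib-* b a⁻¹ n ⟩
      b ^′ n * a⁻¹ ^′ n        ≈⟨ *-congʳ aⁿ≈bⁿ ⟨
      a ^′ n * a⁻¹ ^′ n        ≈⟨ ^′-inverse aa⁻¹≈1 n ⟩
      1#                       ∎

  inverse-root-of-unity : ∀ {t z} n → t ^′ n ≈ 1# → t * z ≈ 1# → z ^′ n ≈ 1#
  inverse-root-of-unity {t} {z} n tⁿ≈1 tz≈1 = begin
    z ^′ n             ≈⟨ *-identityˡ _ ⟨
    1# * z ^′ n        ≈⟨ *-congʳ tⁿ≈1 ⟨
    t ^′ n * z ^′ n    ≈⟨ ^′-inverse tz≈1 n ⟩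
    1#                 ∎

  inverse-of-fixed : ∀ n {α y} → y ≉ 0# → α * y ^′ suc n ≈ y → ∃ λ z → z ≉ 0# × z ^′ n ≈ α
  inverse-of-fixed n {α} {y} y≉0 αyⁿ⁺¹≈y = z , *≈1⇒≉0 (trans (*-comm z y) yz≈1) , zⁿ≈α
    where
    z : Carrier
    z = proj₁ (inverse y y≉0)
    yz≈1 : y * z ≈ 1#
    yz≈1 = proj₂ (inverse y y≉0)
    αyⁿ≈1 : α * y ^′ n ≈ 1#
    αyⁿ≈1 = *-cancelˡ y≉0 (begin
      y * (α * y ^′ n)   ≈⟨ solve 3 (λ y α Y → y :* (α :* Y) := α :* (y :* Y)) refl y α (y ^′ n) ⟩
      α * y ^′ suc n     ≈⟨ αyⁿ⁺¹≈y ⟩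
      y                  ≈⟨ *-identityʳ y ⟨
      y * 1#             ∎)
    zⁿ≈α : z ^′ n ≈ α
    zⁿ≈α = begin
      z ^′ n                   ≈⟨ *-identityʳ _ ⟨
      z ^′ n * 1#              ≈⟨ *-congˡ αyⁿ≈1 ⟨
      z ^′ n * (α * y ^′ n)
        ≈⟨ solve 3 (λ Z α Y → Z :* (α :* Y) := α :* (Y :* Z)) refl (z ^′ n) α (y ^′ n) ⟩
      α * (y ^′ n * z ^′ n)    ≈⟨ *-congˡ (^′-inverse yz≈1 n) ⟩
      α * 1#                   ≈⟨ *-identityʳ α ⟩
      α                        ∎

  ^′-cancel-common : ∀ {a b} m n → n ≤ m → a ≉ 0# → b ≉ 0# →
                     a ^′ m * b ^′ n ≈ b ^′ m * a ^′ n → a ^′ (m ∸ n) ≈ b ^′ (m ∸ n)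
  ^′-cancel-common {a} {b} m n n≤m a≉0 b≉0 cross =
    *-cancelˡ (*-nonzero (^′-nonzero n a≉0) (^′-nonzero n b≉0)) (begin
      a ^′ n * b ^′ n * a ^′ e    ≈⟨ swap₂₃ (a ^′ n) (b ^′ n) (a ^′ e) ⟩
      a ^′ n * a ^′ e * b ^′ n    ≈⟨ *-congʳ (split a) ⟨
      a ^′ m * b ^′ n             ≈⟨ cross ⟩
      b ^′ m * a ^′ n             ≈⟨ *-congʳ (split b) ⟩
      b ^′ n * b ^′ e * a ^′ n    ≈⟨ swap₂₃ (b ^′ n) (b ^′ e) (a ^′ n) ⟩
      b ^′ n * a ^′ n * b ^′ e    ≈⟨ *-congʳ (*-comm (b ^′ n) (a ^′ n)) ⟩
      a ^′ n * b ^′ n * b ^′ e    ∎)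
    where
    e : ℕ
    e = m ∸ n
    split : ∀ x → x ^′ m ≈ x ^′ n * x ^′ e
    split x = trans (reflexive (cong (x ^′_) (≡.sym (m+[n∸m]≡n n≤m)))) (^′-homo-* x n e)
    swap₂₃ : ∀ x y z → x * y * z ≈ x * z * y
    swap₂₃ = solve 3 (λ x y z → x :* y :* z := x :* z :* y) refl

  ^′-distance : ∀ {a b} m n → a ≉ 0# → b ≉ 0# →
                a ^′ m * b ^′ n ≈ b ^′ m * a ^′ n → a ^′ ∣ m - n ∣ ≈ b ^′ ∣ m - n ∣
  ^′-distance {a} {b} m n a≉0 b≉0 cross with ≤-total m n
  ... | inj₁ m≤n = subst (λ e → a ^′ e ≈ b ^′ e) (≡.sym (ℕ.m≤n⇒∣m-n∣≡n∸m m≤n))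
                     (^′-cancel-common n m m≤n a≉0 b≉0 swapped)
    where
    swapped : a ^′ n * b ^′ m ≈ b ^′ n * a ^′ m
    swapped = trans (*-comm _ _) (trans (sym cross) (*-comm _ _))
  ... | inj₂ n≤m = subst (λ e → a ^′ e ≈ b ^′ e)
                     (≡.sym (≡.trans (ℕ.∣-∣-comm m n) (ℕ.m≤n⇒∣m-n∣≡n∸m n≤m)))
                     (^′-cancel-common m n n≤m a≉0 b≉0 cross)

  ^′-∸≈1 : ∀ {w m n} → n ≤ m → w ^′ (m ∸ n) ≈ 1# → w ^′ m ≈ w ^′ n
  ^′-∸≈1 {w} {m} {n} n≤m wᵉ≈1 = begin
    w ^′ m                  ≡⟨ cong (w ^′_) (m+[n∸m]≡n n≤m) ⟨
    w ^′ (n ℕ.+ (m ∸ n))    ≈⟨ ^′-homo-* w n (m ∸ n) ⟩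
    w ^′ n * w ^′ (m ∸ n)   ≈⟨ *-congˡ wᵉ≈1 ⟩
    w ^′ n * 1#             ≈⟨ *-identityʳ _ ⟩
    w ^′ n                  ∎

  ^′-distance≈1 : ∀ {w} m n → w ^′ ∣ m - n ∣ ≈ 1# → w ^′ m ≈ w ^′ n
  ^′-distance≈1 {w} m n wᵈ≈1 with ≤-total m n
  ... | inj₁ m≤n = sym (^′-∸≈1 m≤n (subst (λ e → w ^′ e ≈ 1#) (ℕ.m≤n⇒∣m-n∣≡n∸m m≤n) wᵈ≈1))
  ... | inj₂ n≤m = ^′-∸≈1 n≤m (subst (λ e → w ^′ e ≈ 1#) ∣m-n∣≡m∸n wᵈ≈1)
    where
    ∣m-n∣≡m∸n : ∣ m - n ∣ ≡ m ∸ n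
    ∣m-n∣≡m∸n = ≡.trans (ℕ.∣-∣-comm m n) (ℕ.m≤n⇒∣m-n∣≡n∸m n≤m)

  -- Polynomial evaluation

  eval-cong : ∀ p {x y} → x ≈ y → eval p x ≈ eval p y
  eval-cong []      x≈y = refl
  eval-cong (a ∷ p) x≈y = +-congˡ (*-cong x≈y (eval-cong p x≈y))

  eval-+ₚ : ∀ p q x → eval (p +ₚ q) x ≈ eval p x + eval q x
  eval-+ₚ []      q       x = sym (+-identityˡ _)
  eval-+ₚ (a ∷ p) []      x = sym (+-identityʳ _)
  eval-+ₚ (a ∷ p) (b ∷ q) x = begin
    a + b + x * eval (p +ₚ q) x              ≈⟨ +-congˡ (*-congˡ (eval-+ₚ p q x)) ⟩
    a + b + x * (eval p x + eval q x)
      ≈⟨ solve 5 (λ a b x u v → a :+ b :+ x :* (u :+ v) := a :+ x :* u :+ (b :+ x :* v)) refl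
                 a b x (eval p x) (eval q x) ⟩
    a + x * eval p x + (b + x * eval q x)    ∎

  eval-scale : ∀ a p x → eval (scale a p) x ≈ a * eval p x
  eval-scale a []      x = sym (zeroʳ a)
  eval-scale a (b ∷ p) x = begin
    a * b + x * eval (scale a p) x   ≈⟨ +-congˡ (*-congˡ (eval-scale a p x)) ⟩
    a * b + x * (a * eval p x)
      ≈⟨ solve 4 (λ a b x u → a :* b :+ x :* (a :* u) := a :* (b :+ x :* u)) refl a b x (eval p x) ⟩
    a * (b + x * eval p x)           ∎

  eval-*ₚ : ∀ p q x → eval (p *ₚ q) x ≈ eval p x * eval q x
  eval-*ₚ []      q x = sym (zeroˡ _)
  eval-*ₚ (a ∷ p) q x = begin
    eval (scale a q +ₚ (0# ∷ p *ₚ q)) x              ≈⟨ eval-+ₚ (scale a q) (0# ∷ p *ₚ q) x ⟩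
    eval (scale a q) x + (0# + x * eval (p *ₚ q) x)  ≈⟨ +-cong (eval-scale a q x) (+-identityˡ _) ⟩
    a * eval q x + x * eval (p *ₚ q) x               ≈⟨ +-congˡ (*-congˡ (eval-*ₚ p q x)) ⟩
    a * eval q x + x * (eval p x * eval q x)
      ≈⟨ solve 4 (λ a x u v → a :* v :+ x :* (u :* v) := (a :+ x :* u) :* v) refl a x (eval p x) (eval q x) ⟩
    (a + x * eval p x) * eval q x                    ∎

  eval-^ₚ : ∀ p n x → eval (p ^ₚ n) x ≈ eval p x ^′ n
  eval-^ₚ p zero    x = trans (+-congˡ (zeroʳ x)) (+-identityʳ 1#)
  eval-^ₚ p (suc n) x = trans (eval-*ₚ p (p ^ₚ n) x) (*-congˡ (eval-^ₚ p n x))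

  eval-compose : ∀ p g x → eval (compose p g) x ≈ eval p (eval g x)
  eval-compose []      g x = refl
  eval-compose (a ∷ p) g x = begin
    eval ((a ∷ []) +ₚ g *ₚ compose p g) x             ≈⟨ eval-+ₚ (a ∷ []) (g *ₚ compose p g) x ⟩
    a + x * 0# + eval (g *ₚ compose p g) x
      ≈⟨ +-cong (trans (+-congˡ (zeroʳ x)) (+-identityʳ a)) (eval-*ₚ g (compose p g) x) ⟩
    a + eval g x * eval (compose p g) x               ≈⟨ +-congˡ (*-congˡ (eval-compose p g x)) ⟩
    a + eval g x * eval p (eval g x)                  ∎

  eval-monomial : ∀ n x → eval (monomial n) x ≈ x ^′ n
  eval-monomial zero    x = trans (+-congˡ (zeroʳ x)) (+-identityʳ 1#)
  eval-monomial (suc n) x = trans (+-identityˡ _) (*-congˡ (eval-monomial n x))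

  eval-≈0 : ∀ p x → (∀ n → coeff p n ≈ 0#) → eval p x ≈ 0#
  eval-≈0 []      x p≈0 = refl
  eval-≈0 (a ∷ p) x p≈0 = begin
    a + x * eval p x   ≈⟨ +-cong (p≈0 0) (*-congˡ (eval-≈0 p x (λ n → p≈0 (suc n)))) ⟩
    0# + x * 0#        ≈⟨ +-identityˡ _ ⟩
    x * 0#             ≈⟨ zeroʳ x ⟩
    0#                 ∎

  eval-≈ₚ : ∀ p q x → p ≈ₚ q → eval p x ≈ eval q x
  eval-≈ₚ []      q       x p≈q = sym (eval-≈0 q x (λ n → sym (p≈q n)))
  eval-≈ₚ (a ∷ p) []      x p≈q = eval-≈0 (a ∷ p) x p≈q
  eval-≈ₚ (a ∷ p) (b ∷ q) x p≈q = +-cong (p≈q 0) (*-congˡ (eval-≈ₚ p q x (λ n → p≈q (suc n))))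

  eval-∷ʳ : ∀ p a x → eval (p ++ a ∷ []) x ≈ eval p x + x ^′ length p * a
  eval-∷ʳ []      a x = begin
    a + x * 0#    ≈⟨ +-congˡ (zeroʳ x) ⟩
    a + 0#        ≈⟨ +-comm a 0# ⟩
    0# + a        ≈⟨ +-congˡ (*-identityˡ a) ⟨
    0# + 1# * a   ∎
  eval-∷ʳ (b ∷ p) a x = begin
    b + x * eval (p ++ a ∷ []) x                 ≈⟨ +-congˡ (*-congˡ (eval-∷ʳ p a x)) ⟩
    b + x * (eval p x + x ^′ length p * a)
      ≈⟨ solve 5 (λ b x u v a → b :+ x :* (u :+ v :* a) := b :+ x :* u :+ x :* v :* a) refl
                 b x (eval p x) (x ^′ length p) a ⟩
    b + x * eval p x + x * x ^′ length p * a     ∎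

  eval-reverse : ∀ {t s} → t * s ≈ 1# → ∀ a p →
                 eval (List.reverse (a ∷ p)) t ≈ t ^′ length p * eval (a ∷ p) s
  eval-reverse {t} {s} ts≈1 a [] = begin
    a + t * 0#          ≈⟨ +-congˡ (zeroʳ t) ⟩
    a + 0#              ≈⟨ +-congˡ (zeroʳ s) ⟨
    a + s * 0#          ≈⟨ *-identityˡ _ ⟨
    1# * (a + s * 0#)   ∎
  eval-reverse {t} {s} ts≈1 a (b ∷ p) = begin
    eval (List.reverse (a ∷ b ∷ p)) t             ≡⟨ cong (λ q → eval q t) (List.unfold-reverse a (b ∷ p)) ⟩
    eval (List.reverse (b ∷ p) ++ a ∷ []) t       ≈⟨ eval-∷ʳ (List.reverse (b ∷ p)) a t ⟩
    eval (List.reverse (b ∷ p)) t + t ^′ length (List.reverse (b ∷ p)) * a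
      ≡⟨ cong (λ n → eval (List.reverse (b ∷ p)) t + t ^′ n * a) (List.length-reverse (b ∷ p)) ⟩
    eval (List.reverse (b ∷ p)) t + t * T * a     ≈⟨ +-congʳ (eval-reverse ts≈1 b p) ⟩
    T * E + t * T * a                             ≈⟨ +-congʳ (trans (*-congʳ ts≈1) (*-identityˡ _)) ⟨
    t * s * (T * E) + t * T * a
      ≈⟨ solve 5 (λ t s T E a → t :* s :* (T :* E) :+ t :* T :* a := t :* T :* (a :+ s :* E)) refl t s T E a ⟩
    t * T * (a + s * E)                           ∎
    where
    T E : Carrier
    T = t ^′ length p
    E = eval (b ∷ p) s

  eval-reverseᵥ : ∀ {t s} → t * s ≈ 1# → ∀ {d} (v : Vec Carrier (suc d)) →
                  eval (toList (reverse v)) t ≈ t ^′ d * eval (toList v) s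
  eval-reverseᵥ {t} {s} ts≈1 {d} (a Vec.∷ v) = begin
    eval (toList (reverse (a Vec.∷ v))) t
      ≡⟨ cong (λ p → eval p t) (Vec.toList-reverse (a Vec.∷ v)) ⟩
    eval (List.reverse (a ∷ toList v)) t
      ≈⟨ eval-reverse ts≈1 a (toList v) ⟩
    t ^′ length (toList v) * eval (a ∷ toList v) s
      ≡⟨ cong (λ n → t ^′ n * eval (a ∷ toList v) s) (Vec.length-toList v) ⟩
    t ^′ d * eval (toList (a Vec.∷ v)) s
      ∎

  -- Roots of polynomials

  x-a+a≈x : ∀ x a → x - a + a ≈ x
  x-a+a≈x x a = trans (+-assoc x (- a) a) (trans (+-congˡ (-‿inverseˡ a)) (+-identityʳ x))

  quotientByLinear : Poly → Carrier → Poly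
  quotientByLinear []              a = []
  quotientByLinear (c ∷ [])        a = []
  quotientByLinear (c ∷ p@(_ ∷ _)) a = eval p a ∷ quotientByLinear p a

  length-quotientByLinear : ∀ p a → length (quotientByLinear p a) ≤ ℕ.pred (length p)
  length-quotientByLinear []              a = z≤n
  length-quotientByLinear (c ∷ [])        a = z≤n
  length-quotientByLinear (c ∷ p@(_ ∷ _)) a = s≤s (length-quotientByLinear p a)

  eval-quotientByLinear : ∀ p a x → eval p x ≈ (x - a) * eval (quotientByLinear p a) x + eval p a
  eval-quotientByLinear []              a x = sym (trans (+-identityʳ _) (zeroʳ _))
  eval-quotientByLinear (c ∷ [])        a x = begin
    c + x * 0#                ≈⟨ +-congˡ (trans (zeroʳ x) (sym (zeroʳ a))) ⟩
    c + a * 0#                ≈⟨ +-identityˡ _ ⟨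
    0# + (c + a * 0#)         ≈⟨ +-congʳ (zeroʳ (x - a)) ⟨
    (x - a) * 0# + (c + a * 0#) ∎
  eval-quotientByLinear (c ∷ p@(_ ∷ _)) a x = begin
    c + x * eval p x                          ≈⟨ +-congˡ (*-cong (sym D+a≈x) (eval-quotientByLinear p a x)) ⟩
    c + (D + a) * (D * eval q x + e)
      ≈⟨ solve 5 (λ c D a Q e → c :+ (D :+ a) :* (D :* Q :+ e) := D :* (e :+ (D :+ a) :* Q) :+ (c :+ a :* e)) refl
                 c D a (eval q x) e ⟩
    D * (e + (D + a) * eval q x) + (c + a * e) ≈⟨ +-congʳ (*-congˡ (+-congˡ (*-congʳ D+a≈x))) ⟩
    D * (e + x * eval q x) + (c + a * e)      ∎
    where
    D e : Carrier
    D = x - a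
    e = eval p a
    q : Poly
    q = quotientByLinear p a
    D+a≈x : D + a ≈ x
    D+a≈x = x-a+a≈x x a

  coeff≈0-from-quotient : ∀ p a → (∀ n → coeff (quotientByLinear p a) n ≈ 0#) → eval p a ≈ 0# →
                          ∀ n → coeff p n ≈ 0#
  coeff≈0-from-quotient []              a q≈0 pa≈0 n       = refl
  coeff≈0-from-quotient (c ∷ [])        a q≈0 pa≈0 zero    =
    trans (sym (trans (+-congˡ (zeroʳ a)) (+-identityʳ c))) pa≈0
  coeff≈0-from-quotient (c ∷ [])        a q≈0 pa≈0 (suc n) = refl
  coeff≈0-from-quotient (c ∷ p@(_ ∷ _)) a q≈0 pa≈0 zero    =
    trans (sym (trans (+-congˡ (trans (*-congˡ (q≈0 0)) (zeroʳ a))) (+-identityʳ c))) pa≈0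
  coeff≈0-from-quotient (c ∷ p@(_ ∷ _)) a q≈0 pa≈0 (suc n) =
    coeff≈0-from-quotient p a (λ m → q≈0 (suc m)) (q≈0 0) n

  many-roots⇒coeff≈0 : ∀ k (pts : Fin k → Carrier) → (∀ {i j} → pts i ≈ pts j → i ≡ j) →
                       ∀ p → length p ≤ k → (∀ i → eval p (pts i) ≈ 0#) → ∀ n → coeff p n ≈ 0#
  many-roots⇒coeff≈0 zero    pts pts-inj []  _     _      n = refl
  many-roots⇒coeff≈0 (suc k) pts pts-inj p   |p|≤k roots =
    coeff≈0-from-quotient p a q≈0 (roots Fin.zero)
    where
    a : Carrier
    a = pts Fin.zero
    q : Poly
    q = quotientByLinear p a
    q-roots : ∀ i → eval q (pts (Fin.suc i)) ≈ 0#
    q-roots i = *-cancelˡ b-a≉0 (begin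
      (b - a) * eval q b              ≈⟨ +-identityʳ _ ⟨
      (b - a) * eval q b + 0#         ≈⟨ +-congˡ (roots Fin.zero) ⟨
      (b - a) * eval q b + eval p a   ≈⟨ eval-quotientByLinear p a b ⟨
      eval p b                        ≈⟨ roots (Fin.suc i) ⟩
      0#                              ≈⟨ zeroʳ _ ⟨
      (b - a) * 0#                    ∎)
      where
      b : Carrier
      b = pts (Fin.suc i)
      b-a≉0 : b - a ≉ 0#
      b-a≉0 b-a≈0 with pts-inj (trans (sym (x-a+a≈x b a)) (trans (+-congʳ b-a≈0) (+-identityˡ a)))
      ... | ()
    q≈0 : ∀ n → coeff q n ≈ 0#
    q≈0 = many-roots⇒coeff≈0 k (λ i → pts (Fin.suc i)) (λ eq → Fin.suc-injective (pts-inj eq))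
            q (≤-trans (length-quotientByLinear p a) (ℕ.pred-mono-≤ |p|≤k)) q-roots

  coeff-scale : ∀ a p n → coeff (scale a p) n ≈ a * coeff p n
  coeff-scale a []      n       = sym (zeroʳ a)
  coeff-scale a (b ∷ p) zero    = refl
  coeff-scale a (b ∷ p) (suc n) = coeff-scale a p n

  coeff-monomial : ∀ n → coeff (monomial n) n ≈ 1#
  coeff-monomial zero    = refl
  coeff-monomial (suc n) = coeff-monomial n

  length-monomial : ∀ n → length (monomial n) ≡ suc n
  length-monomial n = ≡.trans (List.length-++ (replicate n 0#))
                        (≡.trans (cong (ℕ._+ 1) (List.length-replicate n)) (ℕ.+-comm n 1))

  -- The Frobenius map

  ·1-^ : ∀ p k → (p ℕ.^ k) · 1# ≈ (p · 1#) ^′ k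
  ·1-^ p zero    = +-identityʳ 1#
  ·1-^ p (suc k) = trans (×1-homo-* p (p ℕ.^ k)) (*-congˡ (·1-^ p k))

  ·≈0-multiple : ∀ {p c} → p · 1# ≈ 0# → p ∣ c → ∀ z → c · z ≈ 0#
  ·≈0-multiple {p} p·1≈0 (divides q ≡.refl) z = begin
    (q ℕ.* p) · z               ≈⟨ ×-congʳ (q ℕ.* p) (*-identityˡ z) ⟨
    (q ℕ.* p) · (1# * z)        ≈⟨ ×-assoc-* (q ℕ.* p) 1# z ⟨
    (q ℕ.* p) · 1# * z          ≈⟨ *-congʳ (×1-homo-* q p) ⟩
    (q · 1#) * (p · 1#) * z     ≈⟨ *-congʳ (*-congˡ p·1≈0) ⟩
    (q · 1#) * 0# * z           ≈⟨ *-congʳ (zeroʳ _) ⟩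
    0# * z                      ≈⟨ zeroˡ z ⟩
    0#                          ∎

  frobenius-prime : ∀ {p} → Prime p → p · 1# ≈ 0# → ∀ x y → (x + y) ^′ p ≈ x ^′ p + y ^′ p
  frobenius-prime {p@(suc (suc n))} p-prime p·1≈0 x y = begin
    (x + y) ^′ p                                              ≡⟨ ^′≡^ (x + y) p ⟩
    (x + y) ^ p                                               ≈⟨ Binomial.theorem p x y ⟩
    T Fin.zero + Sum.sum inner                                ≈⟨ +-congˡ (Sum.sum-init-last inner) ⟩
    T Fin.zero + (Sum.sum (Vector.init inner) + T (fromℕ p))  ≈⟨ +-cong first (+-cong middle final) ⟩
    y ^′ p + (0# + x ^′ p)                                    ≈⟨ +-congˡ (+-identityˡ _) ⟩
    y ^′ p + x ^′ p                                           ≈⟨ +-comm _ _ ⟩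
    x ^′ p + y ^′ p                                           ∎
    where
    T : Fin (suc p) → Carrier
    T = Binomial.binomialTerm x y p
    inner : Fin p → Carrier
    inner i = T (Fin.suc i)
    first : T Fin.zero ≈ y ^′ p
    first = trans (+-identityʳ _) (trans (*-identityˡ _) (reflexive (≡.sym (^′≡^ y p))))
    middle : Sum.sum (Vector.init inner) ≈ 0#
    middle = trans (Sum.sum-cong-≋ vanishes) (Sum.sum-replicate-zero (suc n))
      where
      vanishes : ∀ i → inner (inject₁ i) ≈ 0#
      vanishes i = ·≈0-multiple p·1≈0 (prime∣C p-prime (s≤s z≤n) (s≤s i<1+n)) _
        where
        i<1+n : toℕ (inject₁ i) < suc n
        i<1+n = subst (_< suc n) (≡.sym (Fin.toℕ-inject₁ i)) (Fin.toℕ<n i)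
    final : T (fromℕ p) ≈ x ^′ p
    final = begin
      T (fromℕ p)                      ≡⟨ cong (λ k → (p C k) · (x ^ k * y ^ (p ∸ k))) (Fin.toℕ-fromℕ p) ⟩
      (p C p) · (x ^ p * y ^ (p ∸ p))  ≡⟨ cong₂ (λ a b → a · (x ^ p * y ^ b)) (nCn≡1 p) (ℕ.n∸n≡0 p) ⟩
      1 · (x ^ p * 1#)                 ≈⟨ +-identityʳ _ ⟩
      x ^ p * 1#                       ≈⟨ *-identityʳ _ ⟩
      x ^ p                            ≡⟨ ^′≡^ x p ⟨
      x ^′ p                           ∎

  frobenius : ∀ {p} → Prime p → p · 1# ≈ 0# →
              ∀ k x y → (x + y) ^′ (p ℕ.^ k) ≈ x ^′ (p ℕ.^ k) + y ^′ (p ℕ.^ k)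
  frobenius {p} p-prime p·1≈0 zero    x y =
    trans (*-identityʳ _) (+-cong (sym (*-identityʳ x)) (sym (*-identityʳ y)))
  frobenius {p} p-prime p·1≈0 (suc k) x y = begin
    (x + y) ^′ (p ℕ.* pᵏ)           ≈⟨ ^′-assocʳ (x + y) p pᵏ ⟨
    ((x + y) ^′ p) ^′ pᵏ            ≈⟨ ^′-congˡ pᵏ (frobenius-prime p-prime p·1≈0 x y) ⟩
    (x ^′ p + y ^′ p) ^′ pᵏ         ≈⟨ frobenius p-prime p·1≈0 k (x ^′ p) (y ^′ p) ⟩
    (x ^′ p) ^′ pᵏ + (y ^′ p) ^′ pᵏ ≈⟨ +-cong (^′-assocʳ x p pᵏ) (^′-assocʳ y p pᵏ) ⟩
    x ^′ (p ℕ.* pᵏ) + y ^′ (p ℕ.* pᵏ) ∎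
    where
    pᵏ : ℕ
    pᵏ = p ℕ.^ k

module FiniteField {c ℓ : Level} (F : Field c ℓ) (m : ℕ) (E : FieldOps.HasCardinality F (suc m)) where
  open Field F
  open FieldOps F
  open FieldProperties F
  open import Algebra.Properties.Semiring.Mult semiring using () renaming (_×_ to _·_)
  import Algebra.Properties.CommutativeMonoid.Sum +-commutativeMonoid as Sum
  import Algebra.Properties.CommutativeMonoid.Sum *-commutativeMonoid as Product
  open import Algebra.Properties.Semiring.Exp semiring using (_^_)
  open import Data.Fin using (punchIn)
  open import Data.Fin.Permutation using (Permutation; permutation)
  open import Function.Bundles using (Inverse)
  open import Relation.Binary.Definitions using (Decidable)
  open import Relation.Nullary using (¬?)
  open import Relation.Nullary.Decidable using (decidable-stable)
  open import Algebra.Properties.Group +-group using () renaming (∙-cancelʳ to +-cancelʳ)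
  open import Algebra.Properties.Ring ring using (-1*x≈-x)
  open import Algebra.Solver.Ring.NaturalCoefficients.Default commutativeSemiring
  open import Function.Definitions using (Congruent; Injective; Surjective)
  open import Relation.Binary.Reasoning.Setoid setoid

  open Inverse E using (to; from; to-cong; from-cong)

  to∘from : ∀ x → to (from x) ≈ x
  to∘from x = Inverse.inverseˡ E ≡.refl

  from∘to : ∀ i → from (to i) ≡ i
  from∘to i = Inverse.inverseʳ E refl

  from-injective : ∀ {x y} → from x ≡ from y → x ≈ y
  from-injective {x} {y} eq = trans (sym (to∘from x)) (trans (to-cong eq) (to∘from y))

  to-injective : ∀ {i j} → to i ≈ to j → i ≡ j
  to-injective {i} {j} eq = ≡.trans (≡.sym (from∘to i)) (≡.trans (from-cong eq) (from∘to j))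

  _≟_ : Decidable _≈_
  x ≟ y with from x Fin.≟ from y
  ... | yes eq  = yes (from-injective eq)
  ... | no  neq = no (λ x≈y → neq (from-cong x≈y))

  ∃-nonroot : ∀ p → length p ≤ suc m → ∀ k → coeff p k ≉ 0# → ∃ λ x → eval p x ≉ 0#
  ∃-nonroot p |p|≤ k coeff≉0 with Fin.any? (λ i → ¬? (eval p (to i) ≟ 0#))
  ... | yes (i , nonroot) = to i , nonroot
  ... | no  all-roots     = ⊥-elim (coeff≉0 (many-roots⇒coeff≈0 (suc m) to to-injective p |p|≤ roots k))
    where
    roots : ∀ i → eval p (to i) ≈ 0#
    roots i = decidable-stable (eval p (to i) ≟ 0#) (λ nonroot → all-roots (i , nonroot))

  ·-card≈0 : ∀ x → suc m · x ≈ 0#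
  ·-card≈0 x = +-cancelʳ (Sum.sum to) _ _ (begin
    suc m · x + Sum.sum to                  ≈⟨ +-congʳ (Sum.sum-replicate (suc m)) ⟨
    Sum.sum {suc m} (λ _ → x) + Sum.sum to  ≈⟨ Sum.∑-distrib-+ (λ _ → x) to ⟨
    Sum.sum (λ i → x + to i)                ≈⟨ Sum.sum-cong-≋ (λ i → to∘from (x + to i)) ⟨
    Sum.sum (λ i → to (shift x i))          ≈⟨ Sum.sum-permute to π ⟨
    Sum.sum to                              ≈⟨ +-identityˡ _ ⟨
    0# + Sum.sum to                         ∎)
    where
    shift : Carrier → Fin (suc m) → Fin (suc m)
    shift a i = from (a + to i)
    shift-inverse : ∀ {a b} → a + b ≈ 0# → ∀ i → shift a (shift b i) ≡ i
    shift-inverse {a} {b} a+b≈0 i = ≡.trans (from-cong (begin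
      a + to (from (b + to i))   ≈⟨ +-congˡ (to∘from _) ⟩
      a + (b + to i)             ≈⟨ +-assoc a b _ ⟨
      a + b + to i               ≈⟨ +-congʳ a+b≈0 ⟩
      0# + to i                  ≈⟨ +-identityˡ _ ⟩
      to i                       ∎)) (from∘to i)
    π : Permutation (suc m) (suc m)
    π = permutation (shift x) (shift (- x)) (shift-inverse (-‿inverseʳ x)) (shift-inverse (-‿inverseˡ x))

  nonzero : Fin m → Carrier
  nonzero j = to (punchIn (from 0#) j)

  nonzero-≉0 : ∀ j → nonzero j ≉ 0#
  nonzero-≉0 j nz≈0 = Fin.punchInᵢ≢i (from 0#) j (≡.trans (≡.sym (from∘to _)) (from-cong nz≈0))

  nonzero-injective : ∀ {j k} → nonzero j ≈ nonzero k → j ≡ k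
  nonzero-injective {j} {k} eq = Fin.punchIn-injective (from 0#) j k (to-injective eq)

  multiplyBy : ∀ {x} → x ≉ 0# → Fin m → Fin m
  multiplyBy {x} x≉0 j = punchOut {i = from 0#} {j = from (x * nonzero j)} product≉0
    where
    product≉0 : from 0# ≢ from (x * nonzero j)
    product≉0 eq = *-nonzero x≉0 (nonzero-≉0 j) (sym (from-injective eq))

  nonzero-multiplyBy : ∀ {x} (x≉0 : x ≉ 0#) j → nonzero (multiplyBy x≉0 j) ≈ x * nonzero j
  nonzero-multiplyBy x≉0 j =
    trans (reflexive (cong to (Fin.punchIn-punchOut _))) (to∘from _)

  lagrange : ∀ x → x ≉ 0# → x ^′ m ≈ 1#
  lagrange x x≉0 = *-cancelʳ (product≉0 m nonzero nonzero-≉0) (begin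
    x ^′ m * Product.sum nonzero                     ≡⟨ cong (_* Product.sum nonzero) (^′≡^ x m) ⟩
    x ^ m * Product.sum nonzero                      ≈⟨ *-congʳ (Product.sum-replicate m) ⟨
    Product.sum {m} (λ _ → x) * Product.sum nonzero  ≈⟨ Product.∑-distrib-+ (λ _ → x) nonzero ⟨
    Product.sum (λ j → x * nonzero j)                ≈⟨ Product.sum-cong-≋ (nonzero-multiplyBy x≉0) ⟨
    Product.sum (λ j → nonzero (multiplyBy x≉0 j))   ≈⟨ Product.sum-permute nonzero π ⟨
    Product.sum nonzero                              ≈⟨ *-identityˡ _ ⟨
    1# * Product.sum nonzero                         ∎)
    where
    product≉0 : ∀ k (g : Fin k → Carrier) → (∀ i → g i ≉ 0#) → Product.sum g ≉ 0#
    product≉0 zero    g g≉0 = 1≉0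
    product≉0 (suc k) g g≉0 =
      *-nonzero (g≉0 Fin.zero) (product≉0 k (λ i → g (Fin.suc i)) (λ i → g≉0 (Fin.suc i)))
    x⁻¹ : Carrier
    x⁻¹ = proj₁ (inverse x x≉0)
    xx⁻¹≈1 : x * x⁻¹ ≈ 1#
    xx⁻¹≈1 = proj₂ (inverse x x≉0)
    x⁻¹≉0 : x⁻¹ ≉ 0#
    x⁻¹≉0 = *≈1⇒≉0 (trans (*-comm x⁻¹ x) xx⁻¹≈1)
    multiplyBy-inverse : ∀ {a b} (a≉0 : a ≉ 0#) (b≉0 : b ≉ 0#) → a * b ≈ 1# →
                         ∀ j → multiplyBy a≉0 (multiplyBy b≉0 j) ≡ j
    multiplyBy-inverse {a} {b} a≉0 b≉0 ab≈1 j = nonzero-injective (begin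
      nonzero (multiplyBy a≉0 (multiplyBy b≉0 j))   ≈⟨ nonzero-multiplyBy a≉0 _ ⟩
      a * nonzero (multiplyBy b≉0 j)                ≈⟨ *-congˡ (nonzero-multiplyBy b≉0 j) ⟩
      a * (b * nonzero j)                           ≈⟨ *-assoc a b _ ⟨
      a * b * nonzero j                             ≈⟨ *-congʳ ab≈1 ⟩
      1# * nonzero j                                ≈⟨ *-identityˡ _ ⟩
      nonzero j                                     ∎)
    π : Permutation m m
    π = permutation (multiplyBy x≉0) (multiplyBy x⁻¹≉0)
          (multiplyBy-inverse x≉0 x⁻¹≉0 xx⁻¹≈1)
          (multiplyBy-inverse x⁻¹≉0 x≉0 (trans (*-comm x⁻¹ x) xx⁻¹≈1))

  injective⇒surjective : ∀ {f} → Congruent _≈_ _≈_ f → Injective _≈_ _≈_ f → Surjective _≈_ _≈_ f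
  injective⇒surjective {f} f-cong f-inj y =
    let i , fi≈y = Fin-injective⇒surjective (λ i → from (f (to i)))
                     (λ eq → to-injective (f-inj (from-injective eq))) (from y)
    in  to i , λ z≈ → trans (f-cong z≈) (from-injective fi≈y)

  ∃-nonroot-x+axⁿ : ∀ {a} k → a ≉ 0# → 2 ℕ.+ k ≤ m → ∃ λ x → x + a * x ^′ (2 ℕ.+ k) ≉ 0#
  ∃-nonroot-x+axⁿ {a} k a≉0 2+k≤m =
    let x , Px≉0 = ∃-nonroot P |P|≤1+m (2 ℕ.+ k) coeff≉0
    in  x , λ x+axⁿ≈0 → Px≉0 (trans (eval-P x) x+axⁿ≈0)
    where
    P : Poly
    P = 0# ∷ 1# ∷ scale a (monomial k)
    |P|≤1+m : length P ≤ suc m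
    |P|≤1+m = subst (λ n → 2 ℕ.+ n ≤ suc m)
                (≡.sym (≡.trans (List.length-map (a *_) (monomial k)) (length-monomial k))) (s≤s 2+k≤m)
    coeff≉0 : coeff P (2 ℕ.+ k) ≉ 0#
    coeff≉0 coeff≈0 = a≉0 (begin
      a                               ≈⟨ *-identityʳ a ⟨
      a * 1#                          ≈⟨ *-congˡ (coeff-monomial k) ⟨
      a * coeff (monomial k) k        ≈⟨ coeff-scale a (monomial k) k ⟨
      coeff P (2 ℕ.+ k)               ≈⟨ coeff≈0 ⟩
      0#                              ∎)
    eval-P : ∀ x → eval P x ≈ x + a * x ^′ (2 ℕ.+ k)
    eval-P x = begin
      0# + x * (1# + x * eval (scale a (monomial k)) x)
        ≈⟨ +-identityˡ _ ⟩
      x * (1# + x * eval (scale a (monomial k)) x)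
        ≈⟨ *-congˡ (+-congˡ (*-congˡ (trans (eval-scale a (monomial k) x) (*-congˡ (eval-monomial k x))))) ⟩
      x * (1# + x * (a * x ^′ k))
        ≈⟨ distribˡ x 1# _ ⟩
      x * 1# + x * (x * (a * x ^′ k))
        ≈⟨ +-cong (*-identityʳ x)
                  (solve 3 (λ x a X → x :* (x :* (a :* X)) := a :* (x :* (x :* X))) refl x a (x ^′ k)) ⟩
      x + a * x ^′ (2 ℕ.+ k)
        ∎

  ∃-non-fixed-point : ∀ k → 2 ℕ.+ k ≤ m → ∃ λ x → x ^′ (2 ℕ.+ k) ≉ x
  ∃-non-fixed-point k 2+k≤m =
    let x , nonroot = ∃-nonroot-x+axⁿ k -1≉0 2+k≤m
    in  x , λ xⁿ≈x → nonroot (trans (+-congˡ (trans (-1*x≈-x _) (-‿cong xⁿ≈x))) (-‿inverseʳ x))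
    where
    -1≉0 : - 1# ≉ 0#
    -1≉0 -1≈0 = 1≉0 (trans (sym (+-identityʳ 1#)) (trans (+-congˡ (sym -1≈0)) (-‿inverseʳ 1#)))

  non-fixed-point⇒root-of-unity : ∀ g k {x} → m ≡ suc k ℕ.* g → x ^′ (2 ℕ.+ k) ≉ x →
                                  (x ^′ suc k) ^′ g ≈ 1# × x ^′ suc k ≉ 1#
  non-fixed-point⇒root-of-unity g k {x} m≡[1+k]g xⁿ≉x = wᵍ≈1 , w≉1
    where
    x≉0 : x ≉ 0#
    x≉0 x≈0 = xⁿ≉x (trans (trans (^′-congˡ (2 ℕ.+ k) x≈0) (zeroˡ _)) (sym x≈0))
    wᵍ≈1 : (x ^′ suc k) ^′ g ≈ 1#
    wᵍ≈1 = trans (^′-assocʳ x (suc k) g)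
             (trans (reflexive (cong (x ^′_) (≡.sym m≡[1+k]g))) (lagrange x x≉0))
    w≉1 : x ^′ suc k ≉ 1#
    w≉1 w≈1 = xⁿ≉x (trans (*-congˡ w≈1) (*-identityʳ x))

  ∃-root-of-unity : ∀ {g} → 2 ≤ g → g ∣ m → .{{_ : ℕ.NonZero m}} → ∃ λ w → w ^′ g ≈ 1# × w ≉ 1#
  ∃-root-of-unity {g} 2≤g (divides zero m≡0) = ⊥-elim (ℕ.≢-nonZero⁻¹ m m≡0)
  ∃-root-of-unity {g} 2≤g (divides (suc k) m≡[1+k]g) =
    let x , xⁿ≉x = ∃-non-fixed-point k 2+k≤m
    in  x ^′ suc k , non-fixed-point⇒root-of-unity g k m≡[1+k]g xⁿ≉x
    where
    2+k≤m : 2 ℕ.+ k ≤ m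
    2+k≤m = subst (2 ℕ.+ k ≤_) (≡.sym m≡[1+k]g)
              (ℕ.+-mono-≤ 2≤g (ℕ.m≤m*n k g {{ℕ.>-nonZero (≤-trans (s≤s z≤n) 2≤g)}}))

module SquareOrderField {c ℓ : Level} (F : Field c ℓ) (q : ℕ)
                        (E : FieldOps.HasCardinality F (suc (suc q) ℕ.* suc (suc q))) where
  open Field F
  open FieldOps F
  open FieldProperties F
  open FiniteField F (suc q ℕ.+ suc q ℕ.* suc (suc q)) E public
  open import Algebra.Properties.Semiring.Mult semiring using (×1-homo-*) renaming (_×_ to _·_)
  open import Algebra.Solver.Ring.NaturalCoefficients.Default commutativeSemiring
  open import Relation.Binary.Reasoning.Setoid setoid

  Q : ℕ
  Q = suc (suc q)

  [Q-1][Q+1]≡Q*Q-1 : (Q ∸ 1) ℕ.* (Q ℕ.+ 1) ≡ Q ℕ.* Q ∸ 1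
  [Q-1][Q+1]≡Q*Q-1 = ≡.trans (cong (suc q ℕ.*_) (ℕ.+-comm Q 1)) (ℕ.*-suc (suc q) Q)

  fermat : ∀ x → x ^′ (Q ℕ.* Q) ≈ x
  fermat x with x ≟ 0#
  ... | yes x≈0 = trans (^′-congˡ (Q ℕ.* Q) x≈0) (trans (zeroˡ _) (sym x≈0))
  ... | no  x≉0 = trans (*-congˡ (lagrange x x≉0)) (*-identityʳ x)

  ^[Q-1]∈μ[Q+1] : ∀ {x} → x ≉ 0# → (x ^′ (Q ∸ 1)) ^′ (Q ℕ.+ 1) ≈ 1#
  ^[Q-1]∈μ[Q+1] {x} x≉0 = trans (^′-assocʳ x (Q ∸ 1) (Q ℕ.+ 1))
    (trans (reflexive (cong (x ^′_) [Q-1][Q+1]≡Q*Q-1)) (lagrange x x≉0))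

  μ[Q+1]-inverse : ∀ {u} → u ^′ (Q ℕ.+ 1) ≈ 1# → u * u ^′ Q ≈ 1#
  μ[Q+1]-inverse {u} u∈μ = trans (reflexive (cong (u ^′_) (ℕ.+-comm 1 Q))) u∈μ

  Q-1∣Q*Q-1 : Q ∸ 1 ∣ Q ℕ.* Q ∸ 1
  Q-1∣Q*Q-1 = divides (Q ℕ.+ 1) (≡.trans (≡.sym [Q-1][Q+1]≡Q*Q-1) (ℕ.*-comm (Q ∸ 1) (Q ℕ.+ 1)))

  Q+1∣Q*Q-1 : Q ℕ.+ 1 ∣ Q ℕ.* Q ∸ 1
  Q+1∣Q*Q-1 = divides (Q ∸ 1) (≡.sym [Q-1][Q+1]≡Q*Q-1)

  ∃-common-root-of-unity : ∀ a b → b ∣ Q ℕ.* Q ∸ 1 → b ≢ 0 → gcd a b ≢ 1 →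
                           ∃ λ w → w ^′ a ≈ 1# × w ^′ b ≈ 1# × w ≉ 1#
  ∃-common-root-of-unity a b b∣Q*Q-1 b≢0 gcd≢1 =
    let w , wᵍ≈1 , w≉1 = ∃-root-of-unity 2≤gcd (∣-trans (gcd[m,n]∣n a b) b∣Q*Q-1)
    in  w , ^′≈1-∣ wᵍ≈1 (gcd[m,n]∣m a b) , ^′≈1-∣ wᵍ≈1 (gcd[m,n]∣n a b) , w≉1
    where
    2≤gcd : 2 ≤ gcd a b
    2≤gcd = ≢0∧≢1⇒2≤ (λ gcd≡0 → b≢0 (gcd[m,n]≡0⇒n≡0 a gcd≡0)) gcd≢1

  module _ {p k} (p-prime : Prime p) (Q≡pᵏ : Q ≡ p ℕ.^ k) where

    characteristic : p · 1# ≈ 0#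
    characteristic with (p · 1#) ≟ 0#
    ... | yes p·1≈0 = p·1≈0
    ... | no  p·1≉0 = ⊥-elim (*-nonzero (^′-nonzero k p·1≉0) (^′-nonzero k p·1≉0) (begin
      (p · 1#) ^′ k * (p · 1#) ^′ k         ≈⟨ *-cong (·1-^ p k) (·1-^ p k) ⟨
      (p ℕ.^ k) · 1# * (p ℕ.^ k) · 1#       ≈⟨ ×1-homo-* (p ℕ.^ k) (p ℕ.^ k) ⟨
      (p ℕ.^ k ℕ.* p ℕ.^ k) · 1#            ≡⟨ cong (λ n → (n ℕ.* n) · 1#) Q≡pᵏ ⟨
      (Q ℕ.* Q) · 1#                        ≈⟨ ·-card≈0 1# ⟩
      0#                                    ∎))

    frobeniusQ : ∀ x y → (x + y) ^′ Q ≈ x ^′ Q + y ^′ Q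
    frobeniusQ x y = subst (λ n → (x + y) ^′ n ≈ x ^′ n + y ^′ n) (≡.sym Q≡pᵏ)
                       (frobenius p-prime characteristic k x y)

    fixed-by-twisted-frobenius : ∀ {α} → α ^′ (Q ℕ.+ 1) ≈ 1# → ∀ w →
                                 α * (w + α * w ^′ Q) ^′ Q ≈ w + α * w ^′ Q
    fixed-by-twisted-frobenius {α} α∈μ w = begin
      α * (w + α * w ^′ Q) ^′ Q               ≈⟨ *-congˡ (frobeniusQ w (α * w ^′ Q)) ⟩
      α * (w ^′ Q + (α * w ^′ Q) ^′ Q)        ≈⟨ *-congˡ (+-congˡ (^′-distrib-* α (w ^′ Q) Q)) ⟩
      α * (w ^′ Q + α ^′ Q * (w ^′ Q) ^′ Q)
        ≈⟨ *-congˡ (+-congˡ (*-congˡ (trans (^′-assocʳ w Q Q) (fermat w)))) ⟩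
      α * (w ^′ Q + α ^′ Q * w)               ≈⟨ distribˡ α (w ^′ Q) _ ⟩
      α * w ^′ Q + α * (α ^′ Q * w)           ≈⟨ +-congˡ (*-assoc α (α ^′ Q) w) ⟨
      α * w ^′ Q + α * α ^′ Q * w
        ≈⟨ +-congˡ (trans (*-congʳ (μ[Q+1]-inverse α∈μ)) (*-identityˡ w)) ⟩
      α * w ^′ Q + w                          ≈⟨ +-comm _ w ⟩
      w + α * w ^′ Q                          ∎

    hilbert90 : ∀ {α} → α ^′ (Q ℕ.+ 1) ≈ 1# → ∃ λ z → z ≉ 0# × z ^′ (Q ∸ 1) ≈ α
    hilbert90 {α} α∈μ =
      let w , y≉0 = ∃-nonroot-x+axⁿ q (root-of-unity⇒≉0 (suc (q ℕ.+ 1)) α∈μ) Q≤Q*Q-1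
      in  inverse-of-fixed (Q ∸ 1) y≉0 (fixed-by-twisted-frobenius α∈μ w)
      where
      Q≤Q*Q-1 : Q ≤ suc q ℕ.+ suc q ℕ.* Q
      Q≤Q*Q-1 = subst (Q ≤_) (ℕ.+-comm (suc q ℕ.* Q) (suc q))
                  (s≤s (ℕ.m≤n+m (suc q) (suc (q ℕ.+ q ℕ.* Q))))

module PermutationCriterion {c ℓ : Level} (F : Field c ℓ) (q : ℕ)
                            (E : FieldOps.HasCardinality F (suc (suc q) ℕ.* suc (suc q))) where
  open Field F
  open FieldOps F
  open FieldProperties F
  open SquareOrderField F q E
  open import Algebra.Solver.Ring.NaturalCoefficients.Default commutativeSemiring
  open import Function.Definitions using (Injective)
  open import Relation.Binary.Reasoning.Setoid setoid

  module Criterion (r d : ℕ) (β : Carrier) (β∈μ : β ^′ (Q ℕ.+ 1) ≈ 1#) (h : Vec Carrier (suc d))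
                   (functional-equation : toList (reverse h) ^ₚ Q ≈ₚ scale β (compose (toList h) (monomial Q)))
                   where

    H : Carrier → Carrier
    H = eval (toList h)

    f : Carrier → Carrier
    f α = α ^′ r * H (α ^′ (Q ∸ 1))

    NoRootsOnμ : Set (c Level.⊔ ℓ)
    NoRootsOnμ = ¬ (∃ λ α → α ^′ (Q ℕ.+ 1) ≈ 1# × H α ≈ 0#)

    f-by-powers : ∀ {x y} → x ^′ r ≈ y ^′ r → x ^′ (Q ∸ 1) ≈ y ^′ (Q ∸ 1) → f x ≈ f y
    f-by-powers xʳ≈yʳ xᵠ⁻¹≈yᵠ⁻¹ = *-cong xʳ≈yʳ (eval-cong (toList h) xᵠ⁻¹≈yᵠ⁻¹)

    f-cong : ∀ {x y} → x ≈ y → f x ≈ f y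
    f-cong x≈y = f-by-powers (^′-congˡ r x≈y) (^′-congˡ (Q ∸ 1) x≈y)

    f-zero : r ≥ 1 → ∀ {x} → x ≈ 0# → f x ≈ 0#
    f-zero (s≤s _) x≈0 = trans (*-congʳ (trans (*-congʳ x≈0) (zeroˡ _))) (zeroˡ _)

    f-twist : ∀ {t} → t ^′ (Q ∸ 1) ≈ 1# → ∀ x → f (t * x) ≈ t ^′ r * f x
    f-twist {t} tᵠ⁻¹≈1 x = begin
      (t * x) ^′ r * H ((t * x) ^′ (Q ∸ 1))
        ≈⟨ *-cong (^′-distrib-* t x r) (eval-cong (toList h) (^′-distrib-* t x (Q ∸ 1))) ⟩
      t ^′ r * x ^′ r * H (t ^′ (Q ∸ 1) * x ^′ (Q ∸ 1))
        ≈⟨ *-congˡ (eval-cong (toList h) (trans (*-congʳ tᵠ⁻¹≈1) (*-identityˡ _))) ⟩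
      t ^′ r * x ^′ r * H (x ^′ (Q ∸ 1))
        ≈⟨ *-assoc _ _ _ ⟩
      t ^′ r * f x
        ∎

    H-on-μ : ∀ {u} → u ^′ (Q ℕ.+ 1) ≈ 1# → u ^′ d * H u ^′ Q ≈ β * H u
    H-on-μ {u} u∈μ = begin
      u ^′ d * H u ^′ Q                ≈⟨ *-congʳ (^′-congˡ d tᵠ≈u) ⟨
      (t ^′ Q) ^′ d * H u ^′ Q         ≈⟨ *-congʳ (^′-comm t Q d) ⟩
      (t ^′ d) ^′ Q * H u ^′ Q         ≈⟨ ^′-distrib-* (t ^′ d) (H u) Q ⟨
      (t ^′ d * H u) ^′ Q              ≈⟨ ^′-congˡ Q (eval-reverseᵥ tu≈1 h) ⟨
      eval reversed t ^′ Q             ≈⟨ eval-^ₚ reversed Q t ⟨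
      eval (reversed ^ₚ Q) t           ≈⟨ eval-≈ₚ (reversed ^ₚ Q) (scale β h∘xᵠ) t functional-equation ⟩
      eval (scale β h∘xᵠ) t            ≈⟨ eval-scale β h∘xᵠ t ⟩
      β * eval h∘xᵠ t                  ≈⟨ *-congˡ (eval-compose (toList h) (monomial Q) t) ⟩
      β * H (eval (monomial Q) t)      ≈⟨ *-congˡ (eval-cong (toList h) (trans (eval-monomial Q t) tᵠ≈u)) ⟩
      β * H u                          ∎
      where
      reversed h∘xᵠ : Poly
      reversed = toList (reverse h)
      h∘xᵠ = compose (toList h) (monomial Q)
      t : Carrier
      t = u ^′ Q
      tu≈1 : t * u ≈ 1#
      tu≈1 = trans (*-comm t u) (μ[Q+1]-inverse u∈μ)
      tᵠ≈u : t ^′ Q ≈ u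
      tᵠ≈u = trans (^′-assocʳ u Q Q) (fermat u)

    f^[Q-1] : ∀ {x} → x ≉ 0# → H (x ^′ (Q ∸ 1)) ≉ 0# →
              f x ^′ (Q ∸ 1) * (x ^′ (Q ∸ 1)) ^′ d ≈ β * (x ^′ (Q ∸ 1)) ^′ r
    f^[Q-1] {x} x≉0 A≉0 = *-cancelʳ A≉0 (begin
      f x ^′ (Q ∸ 1) * u ^′ d * A
        ≈⟨ *-congʳ (*-congʳ (^′-distrib-* (x ^′ r) A (Q ∸ 1))) ⟩
      (x ^′ r) ^′ (Q ∸ 1) * A ^′ (Q ∸ 1) * u ^′ d * A
        ≈⟨ *-congʳ (*-congʳ (*-congʳ (^′-comm x r (Q ∸ 1)))) ⟩
      u ^′ r * A ^′ (Q ∸ 1) * u ^′ d * A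
        ≈⟨ solve 4 (λ U B D A → U :* B :* D :* A := U :* (D :* (A :* B))) refl
                   (u ^′ r) (A ^′ (Q ∸ 1)) (u ^′ d) A ⟩
      u ^′ r * (u ^′ d * A ^′ Q)
        ≈⟨ *-congˡ (H-on-μ (^[Q-1]∈μ[Q+1] x≉0)) ⟩
      u ^′ r * (β * A)
        ≈⟨ solve 3 (λ U b A → U :* (b :* A) := b :* U :* A) refl (u ^′ r) β A ⟩
      β * u ^′ r * A
        ∎)
      where
      u A : Carrier
      u = x ^′ (Q ∸ 1)
      A = H u

    β≉0 : β ≉ 0#
    β≉0 = root-of-unity⇒≉0 (suc (q ℕ.+ 1)) β∈μ

    module Sufficiency (r≥1 : r ≥ 1) (coprime-r : gcd r (Q ∸ 1) ≡ 1)
                       (coprime-r-d : gcd ∣ r - d ∣ (Q ℕ.+ 1) ≡ 1) (no-roots : NoRootsOnμ) where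

      H≉0 : ∀ {x} → x ≉ 0# → H (x ^′ (Q ∸ 1)) ≉ 0#
      H≉0 x≉0 Hu≈0 = no-roots (_ , ^[Q-1]∈μ[Q+1] x≉0 , Hu≈0)

      f≉0 : ∀ {x} → x ≉ 0# → f x ≉ 0#
      f≉0 x≉0 = *-nonzero (^′-nonzero r x≉0) (H≉0 x≉0)

      f-injective-≉0 : ∀ {x y} → x ≉ 0# → y ≉ 0# → f x ≈ f y → x ≈ y
      f-injective-≉0 {x} {y} x≉0 y≉0 fx≈fy = ^′-injective-coprime r (Q ∸ 1) coprime-r y≉0 xʳ≈yʳ u≈v
        where
        u v : Carrier
        u = x ^′ (Q ∸ 1)
        v = y ^′ (Q ∸ 1)
        cross : u ^′ r * v ^′ d ≈ v ^′ r * u ^′ d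
        cross = *-cancelˡ β≉0 (begin
          β * (u ^′ r * v ^′ d)              ≈⟨ *-assoc β _ _ ⟨
          β * u ^′ r * v ^′ d                ≈⟨ *-congʳ (f^[Q-1] x≉0 (H≉0 x≉0)) ⟨
          f x ^′ (Q ∸ 1) * u ^′ d * v ^′ d   ≈⟨ *-congʳ (*-congʳ (^′-congˡ (Q ∸ 1) fx≈fy)) ⟩
          f y ^′ (Q ∸ 1) * u ^′ d * v ^′ d   ≈⟨ *-assoc _ _ _ ⟩
          f y ^′ (Q ∸ 1) * (u ^′ d * v ^′ d) ≈⟨ *-congˡ (*-comm _ _) ⟩
          f y ^′ (Q ∸ 1) * (v ^′ d * u ^′ d) ≈⟨ *-assoc _ _ _ ⟨
          f y ^′ (Q ∸ 1) * v ^′ d * u ^′ d   ≈⟨ *-congʳ (f^[Q-1] y≉0 (H≉0 y≉0)) ⟩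
          β * v ^′ r * u ^′ d                ≈⟨ *-assoc β _ _ ⟩
          β * (v ^′ r * u ^′ d)              ∎)
        u≈v : u ≈ v
        u≈v = ^′-injective-coprime ∣ r - d ∣ (Q ℕ.+ 1) coprime-r-d (^′-nonzero (Q ∸ 1) y≉0)
                (^′-distance r d (^′-nonzero (Q ∸ 1) x≉0) (^′-nonzero (Q ∸ 1) y≉0) cross)
                (trans (^[Q-1]∈μ[Q+1] x≉0) (sym (^[Q-1]∈μ[Q+1] y≉0)))
        xʳ≈yʳ : x ^′ r ≈ y ^′ r
        xʳ≈yʳ = *-cancelʳ (H≉0 x≉0) (trans fx≈fy (*-congˡ (eval-cong (toList h) (sym u≈v))))

      f-injective : Injective _≈_ _≈_ f
      f-injective {x} {y} fx≈fy with x ≟ 0# | y ≟ 0#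
      ... | yes x≈0 | yes y≈0 = trans x≈0 (sym y≈0)
      ... | yes x≈0 | no  y≉0 = ⊥-elim (f≉0 y≉0 (trans (sym fx≈fy) (f-zero r≥1 x≈0)))
      ... | no  x≉0 | yes y≈0 = ⊥-elim (f≉0 x≉0 (trans fx≈fy (f-zero r≥1 y≈0)))
      ... | no  x≉0 | no  y≉0 = f-injective-≉0 x≉0 y≉0 fx≈fy

      f-permutes : Permutes f
      f-permutes = f-injective , injective⇒surjective f-cong f-injective

    module Necessity {p k} (p-prime : Prime p) (Q≡pᵏ : Q ≡ p ℕ.^ k) (r≥1 : r ≥ 1)
                     (f-injective : Injective _≈_ _≈_ f) where

      f≉0 : ∀ {x} → x ≉ 0# → f x ≉ 0#
      f≉0 x≉0 fx≈0 = x≉0 (f-injective (trans fx≈0 (sym (f-zero r≥1 refl))))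

      no-roots : NoRootsOnμ
      no-roots (α , α∈μ , Hα≈0) =
        let z , z≉0 , zᵠ⁻¹≈α = hilbert90 {k = k} p-prime Q≡pᵏ α∈μ
        in  f≉0 z≉0 (trans (*-congˡ (trans (eval-cong (toList h) zᵠ⁻¹≈α) Hα≈0)) (zeroʳ _))

      coprime-r : gcd r (Q ∸ 1) ≡ 1
      coprime-r with gcd r (Q ∸ 1) ℕ.≟ 1
      ... | yes gcd≡1 = gcd≡1
      ... | no  gcd≢1 =
        let w , wʳ≈1 , wᵠ⁻¹≈1 , w≉1 = ∃-common-root-of-unity r (Q ∸ 1) Q-1∣Q*Q-1 (λ ()) gcd≢1
        in  ⊥-elim (w≉1 (f-injective (f-by-powers (trans wʳ≈1 (sym (1^′n≈1 r)))
                                                  (trans wᵠ⁻¹≈1 (sym (1^′n≈1 (Q ∸ 1)))))))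

      f^[Q-1]≈β : ∀ {x} → x ≉ 0# → (x ^′ (Q ∸ 1)) ^′ r ≈ (x ^′ (Q ∸ 1)) ^′ d →
                  f x ^′ (Q ∸ 1) ≈ β
      f^[Q-1]≈β {x} x≉0 uʳ≈uᵈ = *-cancelʳ (^′-nonzero d (^′-nonzero (Q ∸ 1) x≉0))
        (trans (f^[Q-1] x≉0 (λ Hu≈0 → no-roots (_ , ^[Q-1]∈μ[Q+1] x≉0 , Hu≈0))) (*-congˡ uʳ≈uᵈ))

      f1^[Q-1]≈β : f 1# ^′ (Q ∸ 1) ≈ β
      f1^[Q-1]≈β = f^[Q-1]≈β 1≉0 (trans (1^^≈1 r) (sym (1^^≈1 d)))
        where
        1^^≈1 : ∀ n → (1# ^′ (Q ∸ 1)) ^′ n ≈ 1#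
        1^^≈1 n = trans (^′-congˡ n (1^′n≈1 (Q ∸ 1))) (1^′n≈1 n)

      f^[Q-1]≈β⇒^[Q-1]≈1 : ∀ {z} → z ≉ 0# → f z ^′ (Q ∸ 1) ≈ β → z ^′ (Q ∸ 1) ≈ 1#
      f^[Q-1]≈β⇒^[Q-1]≈1 {z} z≉0 fzᵠ⁻¹≈β =
        let t , tᵠ⁻¹≈1 , tʳfz≈f1 =
              ∃-root-of-ratio r (Q ∸ 1) coprime-r (f≉0 z≉0) (trans fzᵠ⁻¹≈β (sym f1^[Q-1]≈β))
        in  inverse-root-of-unity (Q ∸ 1) tᵠ⁻¹≈1 (f-injective (trans (f-twist tᵠ⁻¹≈1 z) tʳfz≈f1))

      μ-trivial : ∀ {w} → w ^′ (Q ℕ.+ 1) ≈ 1# → w ^′ r ≈ w ^′ d → w ≈ 1#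
      μ-trivial {w} w∈μ wʳ≈wᵈ =
        let z , z≉0 , zᵠ⁻¹≈w = hilbert90 {k = k} p-prime Q≡pᵏ w∈μ
        in  trans (sym zᵠ⁻¹≈w) (f^[Q-1]≈β⇒^[Q-1]≈1 z≉0 (f^[Q-1]≈β z≉0
              (trans (^′-congˡ r zᵠ⁻¹≈w) (trans wʳ≈wᵈ (sym (^′-congˡ d zᵠ⁻¹≈w))))))

      coprime-r-d : gcd ∣ r - d ∣ (Q ℕ.+ 1) ≡ 1
      coprime-r-d with gcd ∣ r - d ∣ (Q ℕ.+ 1) ℕ.≟ 1
      ... | yes gcd≡1 = gcd≡1
      ... | no  gcd≢1 =
        let w , wᵈⁱˢᵗ≈1 , w∈μ , w≉1 =
              ∃-common-root-of-unity ∣ r - d ∣ (Q ℕ.+ 1) Q+1∣Q*Q-1 (λ ()) gcd≢1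
        in  ⊥-elim (w≉1 (μ-trivial w∈μ (^′-distance≈1 r d wᵈⁱˢᵗ≈1)))

theorem5p1 : ∀ {c ℓ} (F : Field c ℓ) → let open Field F in let open FieldOps F in
    (Q r d : ℕ) → IsPrimePower Q → HasCardinality (Q ℕ.* Q) → r ≥ 1 →
    (β : Carrier) → β ^′ (Q ℕ.+ 1) ≈ 1# →
    (h : Vec Carrier (suc d)) → ¬ (last h ≈ 0#) → ¬ (head h ≈ 0#) →
    (toList (reverse h)) ^ₚ Q ≈ₚ scale β (compose (toList h) (monomial Q)) →
    Permutes (λ α → α ^′ r * eval (toList h) (α ^′ (Q ∸ 1)))
      ⇔ (gcd r (Q ∸ 1) ≡ 1
         × gcdℤ (+ r ℤ.- + d) (+ (Q ℕ.+ 1)) ≡ + 1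
         × ¬ (∃ λ α → α ^′ (Q ℕ.+ 1) ≈ 1# × eval (toList h) α ≈ 0#))
theorem5p1 F Q r d Q-prime-power@(p , k , p-prime , _ , Q≡pᵏ) E r≥1 β β∈μ h _ _ functional-equation
  with prime-power⇒2≤ Q-prime-power
... | s≤s (s≤s {n = q} _) = mk⇔
  (λ (f-injective , _) →
     let open Necessity {k = k} p-prime Q≡pᵏ r≥1 f-injective
     in  coprime-r , ≡.trans (gcdℤ-distance r d (Q ℕ.+ 1)) (cong +_ coprime-r-d) , no-roots)
  (λ (coprime-r , coprime-r-d , no-roots) →
     Sufficiency.f-permutes r≥1 coprime-r
       (ℤ.+-injective (≡.trans (≡.sym (gcdℤ-distance r d (Q ℕ.+ 1))) coprime-r-d)) no-roots)
  where
  open PermutationCriterion F q E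
  open Criterion r d β β∈μ h functional-equation
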